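{- The theories $\mathbb{T}$ and $\mathsf{ACST^{fin}}+\text{Set Induction}$ are identical, i.e. each proves every axiom of the other.
   Context: Intuitionistic set theory in the language $\{\in\}$. An ordinal is a transitive set of transitive sets; $\alpha^+=\alpha\cup\{\alpha\}$; $\omega$ is the class of ordinals $\alpha$ such that every element of $\alpha^+$ is $\varnothing$ or $\gamma^+$ for some ordinal $\gamma$. $V=\mathrm{Fin}$: for each set $x$ there are $n\in\omega$ and a bijection $f:n\to x$. Set Induction is the scheme $\forall x[\forall y\in x\phi(y)\to\phi(x)]\to\forall x\phi(x)$ for all $\phi$. $\mathbb{T}$: Extensionality, Pairing, Union, Binary Intersection ($\forall a,b\exists c\forall z(z\in c\leftrightarrow z\in a\land z\in b)$), Set Induction, $V=\mathrm{Fin}$. $\mathsf{ACST}$: Extensionality, Empty set, Binary Intersection, Pairing, the Global Union-Replacement Rule scheme $\forall u\exists!v\,\phi(u,v)\to\forall x\exists y\forall z[z\in y\leftrightarrow\exists v(z\in v\land\exists u\in x\,\phi(u,v))]$, and the Mathematical Induction scheme: for every definable class $X$, if $0\in X$ and $\forall x\in X(x^+\in X)$ then $\omega\subseteq X$. $\mathsf{ACST^{fin}}=\mathsf{ACST}+V=\mathrm{Fin}$. -}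

module Defs where

open import Data.Nat using (ℕ; zero; suc; _+_; _∸_)
open import Data.Product using (_×_)

-- First-order language {∈} (with logical equality), de Bruijn indices.

infixr 4 _⇒_
infixr 5 _∨̇_
infixr 6 _∧̇_
infix 7 _∈̇_ _≐_

data Fm : Set where
  _∈̇_ : ℕ → ℕ → Fm
  _≐_ : ℕ → ℕ → Fm
  ⊥̇   : Fm
  _⇒_ : Fm → Fm → Fm
  _∧̇_ : Fm → Fm → Fm
  _∨̇_ : Fm → Fm → Fm
  ∀̇   : Fm → Fm
  ∃̇   : Fm → Fm

lift : (ℕ → ℕ) → ℕ → ℕ
lift ρ zero    = zero
lift ρ (suc n) = suc (ρ n)

rename : (ℕ → ℕ) → Fm → Fm
rename ρ (x ∈̇ y) = ρ x ∈̇ ρ y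
rename ρ (x ≐ y) = ρ x ≐ ρ y
rename ρ ⊥̇       = ⊥̇
rename ρ (A ⇒ B) = rename ρ A ⇒ rename ρ B
rename ρ (A ∧̇ B) = rename ρ A ∧̇ rename ρ B
rename ρ (A ∨̇ B) = rename ρ A ∨̇ rename ρ B
rename ρ (∀̇ A)   = ∀̇ (rename (lift ρ) A)
rename ρ (∃̇ A)   = ∃̇ (rename (lift ρ) A)

shift : Fm → Fm
shift = rename suc

inst : ℕ → Fm → Fm
inst x = rename σ
  where
  σ : ℕ → ℕ
  σ zero    = x
  σ (suc n) = n

-- Intuitionistic first-order logic with equality (Hilbert system).
-- A theory is a predicate on formulas; open axioms stand for their
-- universal closures (generalisation is built into ∀-rule).

Theory : Set₁
Theory = Fm → Set

infix 2 _⊢_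

data _⊢_ (T : Theory) : Fm → Set where
  ax    : ∀ {A} → T A → T ⊢ A
  mp    : ∀ {A B} → T ⊢ A ⇒ B → T ⊢ A → T ⊢ B
  K     : ∀ {A B} → T ⊢ A ⇒ B ⇒ A
  S     : ∀ {A B C} → T ⊢ (A ⇒ B ⇒ C) ⇒ (A ⇒ B) ⇒ A ⇒ C
  ∧-i   : ∀ {A B} → T ⊢ A ⇒ B ⇒ A ∧̇ B
  ∧-e₁  : ∀ {A B} → T ⊢ A ∧̇ B ⇒ A
  ∧-e₂  : ∀ {A B} → T ⊢ A ∧̇ B ⇒ B
  ∨-i₁  : ∀ {A B} → T ⊢ A ⇒ A ∨̇ B
  ∨-i₂  : ∀ {A B} → T ⊢ B ⇒ A ∨̇ B
  ∨-e   : ∀ {A B C} → T ⊢ (A ⇒ C) ⇒ (B ⇒ C) ⇒ A ∨̇ B ⇒ C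
  efq   : ∀ {A} → T ⊢ ⊥̇ ⇒ A
  ∀-e   : ∀ {A} x → T ⊢ ∀̇ A ⇒ inst x A
  ∃-i   : ∀ {A} x → T ⊢ inst x A ⇒ ∃̇ A
  ∀-r   : ∀ {A B} → T ⊢ shift B ⇒ A → T ⊢ B ⇒ ∀̇ A
  ∃-r   : ∀ {A B} → T ⊢ A ⇒ shift B → T ⊢ ∃̇ A ⇒ B
  gen   : ∀ {A} → T ⊢ A → T ⊢ ∀̇ A
  ≐-refl : ∀ x → T ⊢ x ≐ x
  ≐-∈ˡ  : ∀ x y z → T ⊢ x ≐ y ⇒ x ∈̇ z ⇒ y ∈̇ z
  ≐-∈ʳ  : ∀ x y z → T ⊢ x ≐ y ⇒ z ∈̇ x ⇒ z ∈̇ y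
  ≐-≐   : ∀ x y z → T ⊢ x ≐ y ⇒ x ≐ z ⇒ y ≐ z

-- Formula builder with named (de Bruijn level) bound variables.
-- A builder receives the current binder depth d; a bound variable of
-- level l is the de Bruijn index d ∸ suc l.  Free variables (scheme
-- parameters) of a formula built at depth d have index ≥ d.

Bf : Set
Bf = ℕ → Fm

ix : ℕ → ℕ → ℕ
ix d l = d ∸ suc l

infixr 4 _⇒ᵇ_
infix 3 _⇔ᵇ_
infixr 5 _∨ᵇ_
infixr 6 _∧ᵇ_
infix 7 _∈ᵇ_ _≐ᵇ_

_∈ᵇ_ : ℕ → ℕ → Bf
(a ∈ᵇ b) d = ix d a ∈̇ ix d b

_≐ᵇ_ : ℕ → ℕ → Bf
(a ≐ᵇ b) d = ix d a ≐ ix d b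

⊥ᵇ : Bf
⊥ᵇ d = ⊥̇

_⇒ᵇ_ _∧ᵇ_ _∨ᵇ_ _⇔ᵇ_ : Bf → Bf → Bf
(A ⇒ᵇ B) d = A d ⇒ B d
(A ∧ᵇ B) d = A d ∧̇ B d
(A ∨ᵇ B) d = A d ∨̇ B d
A ⇔ᵇ B = (A ⇒ᵇ B) ∧ᵇ (B ⇒ᵇ A)

¬ᵇ : Bf → Bf
¬ᵇ A = A ⇒ᵇ ⊥ᵇ

Πᵇ Σᵇ : (ℕ → Bf) → Bf
Πᵇ f d = ∀̇ (f d (suc d))
Σᵇ f d = ∃̇ (f d (suc d))

Π∈ Σ∈ : ℕ → (ℕ → Bf) → Bf
Π∈ a f = Πᵇ λ x → x ∈ᵇ a ⇒ᵇ f x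
Σ∈ a f = Σᵇ λ x → x ∈ᵇ a ∧ᵇ f x

-- Embedding a formula φ(u, params…): φ's index 0 is u, index k+1 is
-- the k-th parameter.
emb1 : Fm → ℕ → Bf
emb1 φ u d = rename σ φ
  where
  σ : ℕ → ℕ
  σ zero    = ix d u
  σ (suc k) = k + d

-- φ(u, v, params…): index 0 is u, index 1 is v, index k+2 the k-th parameter.
emb2 : Fm → ℕ → ℕ → Bf
emb2 φ u v d = rename σ φ
  where
  σ : ℕ → ℕ
  σ zero          = ix d u
  σ (suc zero)    = ix d v
  σ (suc (suc k)) = k + d

close : Bf → Fm
close b = b 0

Empty : ℕ → Bf
Empty a = Πᵇ λ z → ¬ᵇ (z ∈ᵇ a)

IsSucc : ℕ → ℕ → Bf
IsSucc s x = Πᵇ λ z → z ∈ᵇ s ⇔ᵇ (z ∈ᵇ x ∨ᵇ z ≐ᵇ x)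

Trans : ℕ → Bf
Trans a = Π∈ a λ y → Π∈ y λ z → z ∈ᵇ a

Ord : ℕ → Bf
Ord a = Trans a ∧ᵇ Π∈ a λ b → Trans b

InOmega : ℕ → Bf
InOmega α = Ord α ∧ᵇ (Πᵇ λ s → IsSucc s α ⇒ᵇ
              (Π∈ s λ δ → Empty δ ∨ᵇ (Σᵇ λ γ → Ord γ ∧ᵇ IsSucc δ γ)))

IsPair : ℕ → ℕ → ℕ → Bf
IsPair p a b = Πᵇ λ z → z ∈ᵇ p ⇔ᵇ
  ((Πᵇ λ w → w ∈ᵇ z ⇔ᵇ w ≐ᵇ a) ∨ᵇ (Πᵇ λ w → w ∈ᵇ z ⇔ᵇ (w ≐ᵇ a ∨ᵇ w ≐ᵇ b)))

Rel : ℕ → ℕ → ℕ → Bf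
Rel f a b = Σ∈ f λ p → IsPair p a b

Bij : ℕ → ℕ → ℕ → Bf
Bij f n x =
      (Π∈ f λ p → Σ∈ n λ a → Σ∈ x λ b → IsPair p a b)
   ∧ᵇ (Π∈ n λ a → Σ∈ x λ b → Rel f a b)
   ∧ᵇ (Πᵇ λ a → Πᵇ λ b → Πᵇ λ b' → Rel f a b ⇒ᵇ Rel f a b' ⇒ᵇ b ≐ᵇ b')
   ∧ᵇ (Π∈ x λ b → Σ∈ n λ a → Rel f a b)
   ∧ᵇ (Πᵇ λ a → Πᵇ λ a' → Πᵇ λ b → Rel f a b ⇒ᵇ Rel f a' b ⇒ᵇ a ≐ᵇ a')

Extensionality : Fm
Extensionality = close (Πᵇ λ a → Πᵇ λ b → (Πᵇ λ z → z ∈ᵇ a ⇔ᵇ z ∈ᵇ b) ⇒ᵇ a ≐ᵇ b)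

Pairing : Fm
Pairing = close (Πᵇ λ a → Πᵇ λ b → Σᵇ λ c → Πᵇ λ z → z ∈ᵇ c ⇔ᵇ (z ≐ᵇ a ∨ᵇ z ≐ᵇ b))

Union : Fm
Union = close (Πᵇ λ a → Σᵇ λ c → Πᵇ λ z → z ∈ᵇ c ⇔ᵇ (Σ∈ a λ y → z ∈ᵇ y))

BinaryIntersection : Fm
BinaryIntersection = close (Πᵇ λ a → Πᵇ λ b → Σᵇ λ c → Πᵇ λ z →
  z ∈ᵇ c ⇔ᵇ (z ∈ᵇ a ∧ᵇ z ∈ᵇ b))

EmptySet : Fm
EmptySet = close (Σᵇ λ c → Empty c)

VFin : Fm
VFin = close (Πᵇ λ x → Σᵇ λ n → Σᵇ λ f → InOmega n ∧ᵇ Bij f n x)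

SetInduction : Fm → Fm
SetInduction φ = close
  ((Πᵇ λ x → (Π∈ x λ y → emb1 φ y) ⇒ᵇ emb1 φ x) ⇒ᵇ (Πᵇ λ x → emb1 φ x))

UnionReplacement : Fm → Fm
UnionReplacement φ = close
  ((Πᵇ λ u → Σᵇ λ v → emb2 φ u v ∧ᵇ (Πᵇ λ w → emb2 φ u w ⇒ᵇ w ≐ᵇ v))
   ⇒ᵇ (Πᵇ λ x → Σᵇ λ y → Πᵇ λ z →
         z ∈ᵇ y ⇔ᵇ (Σᵇ λ v → z ∈ᵇ v ∧ᵇ (Σ∈ x λ u → emb2 φ u v))))

MathInduction : Fm → Fm
MathInduction ψ = close
  (((Πᵇ λ e → Empty e ⇒ᵇ emb1 ψ e)
    ∧ᵇ (Πᵇ λ x → emb1 ψ x ⇒ᵇ (Πᵇ λ s → IsSucc s x ⇒ᵇ emb1 ψ s)))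
   ⇒ᵇ (Πᵇ λ α → InOmega α ⇒ᵇ emb1 ψ α))

data 𝕋 : Theory where
  t-ext   : 𝕋 Extensionality
  t-pair  : 𝕋 Pairing
  t-union : 𝕋 Union
  t-inter : 𝕋 BinaryIntersection
  t-ind   : ∀ φ → 𝕋 (SetInduction φ)
  t-fin   : 𝕋 VFin

data ACSTfin+SI : Theory where
  a-ext   : ACSTfin+SI Extensionality
  a-empty : ACSTfin+SI EmptySet
  a-inter : ACSTfin+SI BinaryIntersection
  a-pair  : ACSTfin+SI Pairing
  a-urr   : ∀ φ → ACSTfin+SI (UnionReplacement φ)
  a-mi    : ∀ ψ → ACSTfin+SI (MathInduction ψ)
  a-fin   : ACSTfin+SI VFin
  a-ind   : ∀ φ → ACSTfin+SI (SetInduction φ)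

SameTheory : Theory → Theory → Set
SameTheory T U = (∀ A → T A → U ⊢ A) × (∀ A → U A → T ⊢ A)

-- ACSTfin + Set Induction proves Union as the instance of
-- Union-Replacement for the relation v = u.  Conversely, in 𝕋: the empty set is
-- {a} ∩ a, since by set induction no set is a member of itself; Mathematical
-- Induction for ψ is Set Induction for "α ∈ ω → ψ(α)", because every nonempty
-- α ∈ ω is the successor of one of its elements, which again lies in ω; and for
-- Union-Replacement, V = Fin gives a bijection f : n → x with n ∈ ω, and
-- Mathematical Induction on m shows that for every m ⊆ n the union of the
-- φ-images of f[m] exists (at a successor m ∪ {m}, add the φ-image of f(m) by a
-- binary union, built from Pairing and Union).  For m = n this is the union
-- required by Union-Replacement.

module Submission where

open import Defs
open import Data.Nat using (ℕ; zero; suc; _+_; _≡ᵇ_)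
open import Data.Nat.Properties using (+-comm; ≡ᵇ⇒≡)
open import Data.Product using (_×_; _,_)
open import Data.Sum using (_⊎_; inj₁; inj₂)
open import Data.Unit using (tt)
open import Data.List using (List; []; _∷_; foldr)
open import Data.Bool using (true; false; if_then_else_) renaming (T to True)
open import Function using (_∘_)
open import Relation.Binary.PropositionalEquality

lift-cong : ∀ {ρ ρ'} → (∀ i → ρ i ≡ ρ' i) → ∀ i → lift ρ i ≡ lift ρ' i
lift-cong e zero    = refl
lift-cong e (suc i) = cong suc (e i)

rename-cong : ∀ {ρ ρ'} → (∀ i → ρ i ≡ ρ' i) → ∀ A → rename ρ A ≡ rename ρ' A
rename-cong e (x ∈̇ y) = cong₂ _∈̇_ (e x) (e y)
rename-cong e (x ≐ y) = cong₂ _≐_ (e x) (e y)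
rename-cong e ⊥̇       = refl
rename-cong e (A ⇒ B) = cong₂ _⇒_ (rename-cong e A) (rename-cong e B)
rename-cong e (A ∧̇ B) = cong₂ _∧̇_ (rename-cong e A) (rename-cong e B)
rename-cong e (A ∨̇ B) = cong₂ _∨̇_ (rename-cong e A) (rename-cong e B)
rename-cong e (∀̇ A)   = cong ∀̇ (rename-cong (lift-cong e) A)
rename-cong e (∃̇ A)   = cong ∃̇ (rename-cong (lift-cong e) A)

lift-∘ : ∀ ρ σ i → lift ρ (lift σ i) ≡ lift (ρ ∘ σ) i
lift-∘ ρ σ zero    = refl
lift-∘ ρ σ (suc i) = refl

rename-∘ : ∀ ρ σ A → rename ρ (rename σ A) ≡ rename (ρ ∘ σ) A
rename-∘ ρ σ (x ∈̇ y) = refl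
rename-∘ ρ σ (x ≐ y) = refl
rename-∘ ρ σ ⊥̇       = refl
rename-∘ ρ σ (A ⇒ B) = cong₂ _⇒_ (rename-∘ ρ σ A) (rename-∘ ρ σ B)
rename-∘ ρ σ (A ∧̇ B) = cong₂ _∧̇_ (rename-∘ ρ σ A) (rename-∘ ρ σ B)
rename-∘ ρ σ (A ∨̇ B) = cong₂ _∨̇_ (rename-∘ ρ σ A) (rename-∘ ρ σ B)
rename-∘ ρ σ (∀̇ A)   = cong ∀̇ (trans (rename-∘ (lift ρ) (lift σ) A) (rename-cong (lift-∘ ρ σ) A))
rename-∘ ρ σ (∃̇ A)   = cong ∃̇ (trans (rename-∘ (lift ρ) (lift σ) A) (rename-cong (lift-∘ ρ σ) A))

lift-id : ∀ {ρ} → (∀ i → ρ i ≡ i) → ∀ i → lift ρ i ≡ i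
lift-id e zero    = refl
lift-id e (suc i) = cong suc (e i)

rename-id : ∀ {ρ} → (∀ i → ρ i ≡ i) → ∀ A → rename ρ A ≡ A
rename-id e (x ∈̇ y) = cong₂ _∈̇_ (e x) (e y)
rename-id e (x ≐ y) = cong₂ _≐_ (e x) (e y)
rename-id e ⊥̇       = refl
rename-id e (A ⇒ B) = cong₂ _⇒_ (rename-id e A) (rename-id e B)
rename-id e (A ∧̇ B) = cong₂ _∧̇_ (rename-id e A) (rename-id e B)
rename-id e (A ∨̇ B) = cong₂ _∨̇_ (rename-id e A) (rename-id e B)
rename-id e (∀̇ A)   = cong ∀̇ (rename-id (lift-id e) A)
rename-id e (∃̇ A)   = cong ∃̇ (rename-id (lift-id e) A)

inst-zero-lift-suc : ∀ A → inst 0 (rename (lift suc) A) ≡ A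
inst-zero-lift-suc A =
  trans (rename-∘ _ (lift suc) A) (rename-id (λ { zero → refl ; (suc i) → refl }) A)

-- Under binders and instantiations an occurrence of a scheme formula φ turns into a
-- tower rename ρ₁ (⋯ (rename g φ)) that is stuck on φ, so two occurrences denoting
-- the same formula are in general only propositionally equal.  leaf-cast below
-- identifies them by comparing the composite renamings on the variables of φ; the
-- heights of the towers are passed explicitly because Agda cannot infer the spine.

renameAll : List (ℕ → ℕ) → Fm → Fm
renameAll ρs A = foldr rename A ρs

composeAll : List (ℕ → ℕ) → ℕ → ℕ
composeAll ρs i = foldr (λ ρ j → ρ j) i ρs

renameAll-rename : ∀ ρs σ A → renameAll ρs (rename σ A) ≡ rename (composeAll ρs ∘ σ) A
renameAll-rename []       σ A = refl
renameAll-rename (ρ ∷ ρs) σ A = trans (cong (rename ρ) (renameAll-rename ρs σ A)) (rename-∘ ρ _ A)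

WithRenamings : ℕ → (List (ℕ → ℕ) → Set) → Set
WithRenamings zero    P = P []
WithRenamings (suc k) P = ∀ {ρ} → WithRenamings k λ ρs → P (ρ ∷ ρs)

withRenamings : ∀ k {P} → (∀ ρs → P ρs) → WithRenamings k P
withRenamings zero    p = p []
withRenamings (suc k) p {ρ} = withRenamings k (λ ρs → p (ρ ∷ ρs))

shiftⁿ : ℕ → Fm → Fm
shiftⁿ zero    A = A
shiftⁿ (suc k) A = shift (shiftⁿ k A)

replace : ℕ → ℕ → ℕ → ℕ
replace x y i = if i ≡ᵇ x then y else i

Equated : ℕ → ℕ → (ℕ → ℕ) → (ℕ → ℕ) → Set
Equated x y ρ ρ' = ∀ i → ρ i ≡ ρ' i ⊎ (ρ i ≡ x × ρ' i ≡ y) ⊎ (ρ i ≡ y × ρ' i ≡ x)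

Equated-sym : ∀ {x y ρ ρ'} → Equated x y ρ ρ' → Equated x y ρ' ρ
Equated-sym E i with E i
... | inj₁ e                 = inj₁ (sym e)
... | inj₂ (inj₁ (e , e'))   = inj₂ (inj₂ (e' , e))
... | inj₂ (inj₂ (e , e'))   = inj₂ (inj₁ (e' , e))

Equated-lift : ∀ {x y ρ ρ'} → Equated x y ρ ρ' → Equated (suc x) (suc y) (lift ρ) (lift ρ')
Equated-lift E zero = inj₁ refl
Equated-lift E (suc i) with E i
... | inj₁ e                 = inj₁ (cong suc e)
... | inj₂ (inj₁ (e , e'))   = inj₂ (inj₁ (cong suc e , cong suc e'))
... | inj₂ (inj₂ (e , e'))   = inj₂ (inj₂ (cong suc e , cong suc e'))

Equated-replace : ∀ x y → Equated x y (λ i → i) (replace x y)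
Equated-replace x y i with i ≡ᵇ x in eq
... | true  = inj₂ (inj₁ (≡ᵇ⇒≡ i x (subst True (sym eq) tt) , refl))
... | false = inj₁ refl

-- Natural deduction inside the Hilbert system: C ▷ A derives A from the assumptions C,
-- a right-nested conjunction whose head is the most recent assumption, fetched by # 0.

hypothesis : Fm → ℕ → Fm
hypothesis (A ∧̇ _) zero    = A
hypothesis (_ ∧̇ C) (suc k) = hypothesis C k
hypothesis C       _       = C

module Derivation (T : Theory) where

  infix 1 _▷_
  _▷_ : Fm → Fm → Set
  C ▷ A = T ⊢ C ⇒ A

  ⇒-refl : ∀ {A} → T ⊢ A ⇒ A
  ⇒-refl {A} = mp (mp S (K {B = A ⇒ A})) K

  combB : ∀ {A B D} → T ⊢ (B ⇒ D) ⇒ (A ⇒ B) ⇒ A ⇒ D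
  combB = mp (mp S (mp K S)) K

  combC : ∀ {A B D} → T ⊢ (A ⇒ B ⇒ D) ⇒ B ⇒ A ⇒ D
  combC = mp (mp S (mp (mp combB combB) S)) (mp K K)

  app : ∀ {C A B} → C ▷ A ⇒ B → C ▷ A → C ▷ B
  app f a = mp (mp S f) a

  pure : ∀ {C A} → T ⊢ A → C ▷ A
  pure = mp K

  lam : ∀ {C A B} → A ∧̇ C ▷ B → C ▷ A ⇒ B
  lam f = app (app (pure combB) (pure f)) (app (app (pure combC) (pure ∧-i)) ⇒-refl)

  cut : ∀ {C A B} → C ▷ A → A ∧̇ C ▷ B → C ▷ B
  cut a g = app (lam g) a

  wk : ∀ {C A B} → C ▷ A → B ∧̇ C ▷ A
  wk f = app (pure f) ∧-e₂

  # : ∀ k {C} → C ▷ hypothesis C k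
  # zero    {A ∧̇ C} = ∧-e₁
  # (suc k) {A ∧̇ C} = wk (# k)
  # _       {_ ∈̇ _} = ⇒-refl
  # _       {_ ≐ _} = ⇒-refl
  # _       {⊥̇}     = ⇒-refl
  # _       {_ ⇒ _} = ⇒-refl
  # _       {_ ∨̇ _} = ⇒-refl
  # _       {∀̇ _}   = ⇒-refl
  # _       {∃̇ _}   = ⇒-refl

  ∧I : ∀ {C A B} → C ▷ A → C ▷ B → C ▷ A ∧̇ B
  ∧I a b = app (app (pure ∧-i) a) b

  ∧E₁ : ∀ {C A B} → C ▷ A ∧̇ B → C ▷ A
  ∧E₁ = app (pure ∧-e₁)

  ∧E₂ : ∀ {C A B} → C ▷ A ∧̇ B → C ▷ B
  ∧E₂ = app (pure ∧-e₂)

  ∨I₁ : ∀ {C A B} → C ▷ A → C ▷ A ∨̇ B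
  ∨I₁ = app (pure ∨-i₁)

  ∨I₂ : ∀ {C A B} → C ▷ B → C ▷ A ∨̇ B
  ∨I₂ = app (pure ∨-i₂)

  ∨E : ∀ {C A B D} → C ▷ A ∨̇ B → A ∧̇ C ▷ D → B ∧̇ C ▷ D → C ▷ D
  ∨E h f g = app (app (app (pure ∨-e) (lam f)) (lam g)) h

  ⊥E : ∀ {C A} → C ▷ ⊥̇ → C ▷ A
  ⊥E = app (pure efq)

  ∀I : ∀ {C A} → shift C ▷ A → C ▷ ∀̇ A
  ∀I = ∀-r

  ∀E : ∀ {C A} x → C ▷ ∀̇ A → C ▷ inst x A
  ∀E x = app (pure (∀-e x))

  ∃I : ∀ {C A} x → C ▷ inst x A → C ▷ ∃̇ A
  ∃I x = app (pure (∃-i x))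

  ∃E : ∀ {C A B} → C ▷ ∃̇ A → A ∧̇ shift C ▷ shift B → C ▷ B
  ∃E h g = app (app (pure (∃-r (mp combC (lam g)))) h) ⇒-refl

  cast : ∀ {C A B} → A ≡ B → C ▷ A → C ▷ B
  cast refl h = h

  leaf-cast : ∀ j k A → WithRenamings j λ ρs → WithRenamings k λ σs → ∀ {C g h} →
              C ▷ renameAll ρs (rename g A) →
              composeAll ρs (g 0) ≡ composeAll σs (h 0) →
              composeAll ρs (g 1) ≡ composeAll σs (h 1) →
              (∀ i → composeAll ρs (g (2 + i)) ≡ composeAll σs (h (2 + i))) →
              C ▷ renameAll σs (rename h A)
  leaf-cast j k A = withRenamings j λ ρs → withRenamings k λ σs → λ {C} {g} {h} d e₀ e₁ e₂ →
    cast (trans (renameAll-rename ρs g A) (trans (rename-cong (agree e₀ e₁ e₂) A)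
         (sym (renameAll-rename σs h A)))) d
    where
    agree : ∀ {ρ ρ' : ℕ → ℕ} → ρ 0 ≡ ρ' 0 → ρ 1 ≡ ρ' 1 → (∀ i → ρ (2 + i) ≡ ρ' (2 + i)) →
            ∀ i → ρ i ≡ ρ' i
    agree e₀ e₁ e₂ zero          = e₀
    agree e₀ e₁ e₂ (suc zero)    = e₁
    agree e₀ e₁ e₂ (suc (suc i)) = e₂ i

  ≐I : ∀ {C} x → C ▷ x ≐ x
  ≐I x = pure (≐-refl x)

  ≐-sym : ∀ {C x y} → C ▷ x ≐ y → C ▷ y ≐ x
  ≐-sym {x = x} {y} h = app (app (pure (≐-≐ x y x)) h) (≐I x)

  ≐-trans : ∀ {C x y z} → C ▷ x ≐ y → C ▷ y ≐ z → C ▷ x ≐ z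
  ≐-trans {x = x} {y} {z} h g = app (app (pure (≐-≐ y x z)) (≐-sym h)) g

  ∈-substˡ : ∀ {C x y z} → C ▷ x ≐ y → C ▷ x ∈̇ z → C ▷ y ∈̇ z
  ∈-substˡ {x = x} {y} {z} h g = app (app (pure (≐-∈ˡ x y z)) h) g

  ∈-substʳ : ∀ {C x y z} → C ▷ x ≐ y → C ▷ z ∈̇ x → C ▷ z ∈̇ y
  ∈-substʳ {x = x} {y} {z} h g = app (app (pure (≐-∈ʳ x y z)) h) g

  discharge : ∀ {C A B} → A ▷ B → C ▷ A → C ▷ B
  discharge f a = app (pure f) a

  ≐-Equated : ∀ {x y ρ ρ'} → Equated x y ρ ρ' → ∀ i → x ≐ y ▷ ρ i ≐ ρ' i
  ≐-Equated {ρ' = ρ'} E i with E i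
  ... | inj₁ e               rewrite e       = ≐I (ρ' i)
  ... | inj₂ (inj₁ (e , e')) rewrite e | e'  = ⇒-refl
  ... | inj₂ (inj₂ (e , e')) rewrite e | e'  = ≐-sym ⇒-refl

  ≐-rename : ∀ A {x y ρ ρ'} → Equated x y ρ ρ' → x ≐ y ▷ rename ρ A ⇒ rename ρ' A
  ≐-rename (a ∈̇ b) E = lam (∈-substʳ (wk (≐-Equated E b)) (∈-substˡ (wk (≐-Equated E a)) (# 0)))
  ≐-rename (a ≐ b) E =
    lam (≐-trans (≐-sym (wk (≐-Equated E a))) (≐-trans (# 0) (wk (≐-Equated E b))))
  ≐-rename ⊥̇       E = lam (# 0)
  ≐-rename (A ⇒ B) E = lam (lam (app (discharge (≐-rename B E) (# 2))
                                   (app (# 1) (app (discharge (≐-rename A (Equated-sym E)) (# 2)) (# 0)))))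
  ≐-rename (A ∧̇ B) E = lam (∧I (app (discharge (≐-rename A E) (# 1)) (∧E₁ (# 0)))
                              (app (discharge (≐-rename B E) (# 1)) (∧E₂ (# 0))))
  ≐-rename (A ∨̇ B) E = lam (∨E (# 0) (∨I₁ (app (discharge (≐-rename A E) (# 2)) (# 0)))
                                    (∨I₂ (app (discharge (≐-rename B E) (# 2)) (# 0))))
  ≐-rename (∀̇ A) {ρ = ρ} E =
    lam (∀I (app (discharge (≐-rename A (Equated-lift E)) (# 1))
                 (cast (inst-zero-lift-suc (rename (lift ρ) A)) (∀E 0 (# 0)))))
  ≐-rename (∃̇ A) {ρ' = ρ'} E =
    lam (∃E (# 0) (∃I 0 (cast (sym (inst-zero-lift-suc (rename (lift ρ') A)))
                              (app (discharge (≐-rename A (Equated-lift E)) (# 2)) (# 0)))))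

  ≐-subst : ∀ {C} A {x y} → C ▷ x ≐ y → C ▷ A → C ▷ rename (replace x y) A
  ≐-subst A {x} {y} e h =
    app (discharge (≐-rename A (Equated-replace x y)) e) (cast (sym (rename-id (λ _ → refl) A)) h)

  ⊤̇ : Fm
  ⊤̇ = ⊥̇ ⇒ ⊥̇

  closed : ∀ {A} → ⊤̇ ▷ A → T ⊢ A
  closed f = mp f ⇒-refl

-- apply₁ ψ a e is ψ(a) with the parameters of ψ placed at e, e + 1, … .  Unlike emb1,
-- which places the k-th parameter at k + d, this computes when e is a numeral.

args₁ : ℕ → ℕ → ℕ → ℕ
args₁ a e zero    = a
args₁ a e (suc k) = e + k

apply₁ : Fm → ℕ → ℕ → Fm
apply₁ ψ a e = rename (args₁ a e) ψ

emb1≡apply₁ : ∀ ψ u d → emb1 ψ u d ≡ apply₁ ψ (ix d u) d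
emb1≡apply₁ ψ u d = rename-cong (λ { zero → refl ; (suc k) → +-comm k d }) ψ

args₂ : ℕ → ℕ → ℕ → ℕ → ℕ
args₂ a b e zero          = a
args₂ a b e (suc zero)    = b
args₂ a b e (suc (suc k)) = e + k

apply₂ : Fm → ℕ → ℕ → ℕ → Fm
apply₂ φ a b e = rename (args₂ a b e) φ

apply₂ᵇ : Fm → ℕ → ℕ → Bf
apply₂ᵇ φ u v d = apply₂ φ (ix d u) (ix d v) d

emb2≡apply₂ : ∀ φ u v d → emb2 φ u v d ≡ apply₂ φ (ix d u) (ix d v) d
emb2≡apply₂ φ u v d =
  rename-cong (λ { zero → refl ; (suc zero) → refl ; (suc (suc k)) → +-comm k d }) φ

Equated-args₂ : ∀ a a' b e → Equated a a' (args₂ a b e) (args₂ a' b e)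
Equated-args₂ a a' b e zero          = inj₂ (inj₁ (refl , refl))
Equated-args₂ a a' b e (suc zero)    = inj₁ refl
Equated-args₂ a a' b e (suc (suc k)) = inj₁ refl

-- The axiom schemes with every occurrence of the scheme formula supplied separately,
-- so that an instance can be rewritten occurrence by occurrence.

SetInductionOf : Fm → Fm → Fm
SetInductionOf φ₁ φ₂ =
  close ((Πᵇ λ x → (Π∈ x λ y → λ _ → φ₂) ⇒ᵇ λ _ → φ₁) ⇒ᵇ (Πᵇ λ x → λ _ → φ₁))

InductionBase : Fm → Fm
InductionBase ψ₁ = close (Πᵇ λ e → Empty e ⇒ᵇ λ _ → ψ₁)

InductionStep : Fm → Fm → Fm
InductionStep ψ₁ ψ₂ = close (Πᵇ λ x → (λ _ → ψ₁) ⇒ᵇ (Πᵇ λ s → IsSucc s x ⇒ᵇ λ _ → ψ₂))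

InductionConclusion : Fm → Fm
InductionConclusion ψ₁ = close (Πᵇ λ α → InOmega α ⇒ᵇ λ _ → ψ₁)

MathInductionOf : Fm → Fm → Fm
MathInductionOf ψ₁ ψ₂ = InductionBase ψ₁ ∧̇ InductionStep ψ₁ ψ₂ ⇒ InductionConclusion ψ₁

IsFunctional : Fm → Fm → Fm
IsFunctional φ₁ φ₂ = close (Πᵇ λ u → Σᵇ λ v → (λ _ → φ₁) ∧ᵇ (Πᵇ λ w → (λ _ → φ₂) ⇒ᵇ w ≐ᵇ v))

ReplacementUnion : Fm → ℕ → Bf
ReplacementUnion φ₃ x =
  Σᵇ λ y → Πᵇ λ z → z ∈ᵇ y ⇔ᵇ (Σᵇ λ v → z ∈ᵇ v ∧ᵇ (Σ∈ x λ u → λ _ → φ₃))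

UnionReplacementOf : Fm → Fm → Fm → Fm
UnionReplacementOf φ₁ φ₂ φ₃ = IsFunctional φ₁ φ₂ ⇒ close (Πᵇ λ x → ReplacementUnion φ₃ x)

MathInduction≡ : ∀ ψ → MathInduction ψ ≡ MathInductionOf (apply₁ ψ 0 1) (apply₁ ψ 0 2)
MathInduction≡ ψ = cong₂ MathInductionOf (emb1≡apply₁ ψ 0 1) (emb1≡apply₁ ψ 1 2)

SetInduction-InOmega≡ : ∀ ψ → SetInduction (InOmega 0 1 ⇒ ψ) ≡
  SetInductionOf (InOmega 0 1 ⇒ apply₁ ψ 0 1) (InOmega 0 1 ⇒ apply₁ ψ 0 2)
SetInduction-InOmega≡ ψ =
  cong₂ SetInductionOf (cong (InOmega 0 1 ⇒_) (emb1≡apply₁ ψ 0 1))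
                       (cong (InOmega 0 1 ⇒_) (emb1≡apply₁ ψ 1 2))

UnionReplacement≡ : ∀ φ → UnionReplacement φ ≡
  UnionReplacementOf (apply₂ φ 1 0 2) (apply₂ φ 2 0 3) (apply₂ φ 0 1 5)
UnionReplacement≡ φ = cong₃ (emb2≡apply₂ φ 0 1 2) (emb2≡apply₂ φ 0 2 3) (emb2≡apply₂ φ 4 3 5)
  where
  cong₃ : ∀ {a a' b b' c c'} → a ≡ a' → b ≡ b' → c ≡ c' →
          UnionReplacementOf a b c ≡ UnionReplacementOf a' b' c'
  cong₃ refl refl refl = refl

module _ where
  open Derivation ACSTfin+SI

  replacement-by-identity : ∀ {C} → C ▷ close (Πᵇ λ x → Σᵇ λ y → Πᵇ λ z →
                              z ∈ᵇ y ⇔ᵇ (Σᵇ λ v → z ∈ᵇ v ∧ᵇ (Σ∈ x λ u → v ≐ᵇ u)))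
  replacement-by-identity =
    app (pure (ax (a-urr (1 ≐ 0)))) (∀I (∃I 0 (∧I (≐I 0) (∀I (lam (# 0))))))

  union-from-replacement : ∀ {C} → C ▷ Union
  union-from-replacement =
    ∀I (∃E (∀E 0 replacement-by-identity) (∃I 0 (∀I (cut (∀E 0 (# 0)) (∧I
      (lam (∃E (app (∧E₁ (# 1)) (# 0)) (∃E (∧E₂ (# 0))
        (∃I 1 (∧I (∈-substˡ (≐-sym (∧E₂ (# 0))) (∧E₁ (# 0))) (∧E₁ (# 1)))))))
      (lam (∃E (# 0) (app (∧E₂ (# 2))
        (∃I 0 (∧I (∧E₂ (# 0)) (∃I 0 (∧I (∧E₁ (# 0)) (≐I 0)))))))))))))

  𝕋-axioms-in-ACSTfin+SI : ∀ A → 𝕋 A → ACSTfin+SI ⊢ A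
  𝕋-axioms-in-ACSTfin+SI _ t-ext     = ax a-ext
  𝕋-axioms-in-ACSTfin+SI _ t-pair    = ax a-pair
  𝕋-axioms-in-ACSTfin+SI _ t-union   = closed union-from-replacement
  𝕋-axioms-in-ACSTfin+SI _ t-inter   = ax a-inter
  𝕋-axioms-in-ACSTfin+SI _ (t-ind φ) = ax (a-ind φ)
  𝕋-axioms-in-ACSTfin+SI _ t-fin     = ax a-fin

module _ where
  open Derivation 𝕋

  ∈-irreflexive : ∀ {C} → C ▷ close (Πᵇ λ a → ¬ᵇ (a ∈ᵇ a))
  ∈-irreflexive = app (pure (ax (t-ind (0 ∈̇ 0 ⇒ ⊥̇))))
    (∀I (lam (lam (app (app (∀E 0 (# 1)) (# 0)) (# 0)))))

  empty-set : ∀ {C} → C ▷ EmptySet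
  empty-set = ∃E (∀E 0 (∀E 0 (pure (ax t-pair))))
    (∃E (∀E 1 (∀E 0 (pure (ax t-inter))))
      (∃I 0 (∀I (lam (cut (app (∧E₁ (∀E 0 (# 1))) (# 0))
        (∨E (app (∧E₁ (∀E 0 (# 3))) (∧E₁ (# 0)))
          (app (∀E 3 ∈-irreflexive) (∈-substˡ (# 0) (∧E₂ (# 1))))
          (app (∀E 3 ∈-irreflexive) (∈-substˡ (# 0) (∧E₂ (# 1))))))))))

  binary-union : ∀ {C} → C ▷ close (Πᵇ λ a → Πᵇ λ b → Σᵇ λ c → Πᵇ λ z →
                                      z ∈ᵇ c ⇔ᵇ (z ∈ᵇ a ∨ᵇ z ∈ᵇ b))
  binary-union = ∀I (∀I (∃E (∀E 0 (∀E 1 (pure (ax t-pair)))) (∃E (∀E 0 (pure (ax t-union)))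
    (∃I 0 (∀I (∧I
      (lam (∃E (app (∧E₁ (∀E 0 (# 1))) (# 0))
        (∨E (app (∧E₁ (∀E 0 (# 3))) (∧E₁ (# 0)))
          (∨I₁ (∈-substʳ (# 0) (∧E₂ (# 1))))
          (∨I₂ (∈-substʳ (# 0) (∧E₂ (# 1)))))))
      (lam (∨E (# 0)
        (app (∧E₂ (∀E 0 (# 2))) (∃I 4 (∧I (app (∧E₂ (∀E 4 (# 3))) (∨I₁ (≐I 4))) (# 0))))
        (app (∧E₂ (∀E 0 (# 2))) (∃I 3 (∧I (app (∧E₂ (∀E 3 (# 3))) (∨I₂ (≐I 3))) (# 0))))))))))))

  successor : ∀ {C} → C ▷ close (Πᵇ λ a → Σᵇ λ s → IsSucc s a)
  successor = ∀I (∃E (∀E 0 (∀E 0 (pure (ax t-pair)))) (∃E (∀E 0 (∀E 1 binary-union))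
    (∃I 0 (∀I (∧I
      (lam (∨E (app (∧E₁ (∀E 0 (# 1))) (# 0)) (∨I₁ (# 0))
        (∨E (app (∧E₁ (∀E 0 (# 3))) (# 0)) (∨I₂ (# 0)) (∨I₂ (# 0)))))
      (lam (app (∧E₂ (∀E 0 (# 1)))
        (∨E (# 0) (∨I₁ (# 0)) (∨I₂ (app (∧E₂ (∀E 0 (# 3))) (∨I₁ (# 0))))))))))))

  ω-predecessor : ∀ {C} → C ▷ close (Πᵇ λ α → Πᵇ λ s → Πᵇ λ γ →
                    InOmega α ⇒ᵇ IsSucc s α ⇒ᵇ Ord γ ⇒ᵇ IsSucc α γ ⇒ᵇ InOmega γ)
  ω-predecessor = ∀I (∀I (∀I (lam (lam (lam (lam (∧I (# 1) (∀I (lam (∀I (lam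
    (app (∀E 0 (app (∀E 3 (∧E₂ (# 5))) (# 4)))
      (app (∧E₂ (∀E 0 (# 4))) (∨I₁ (∨E (app (∧E₁ (∀E 0 (# 1))) (# 0))
        (app (∧E₂ (∀E 0 (# 3))) (∨I₁ (# 0)))
        (∈-substˡ (≐-sym (# 0)) (app (∧E₂ (∀E 2 (# 3))) (∨I₂ (≐I 2)))))))))))))))))))

  ω-cases : ∀ {C} → C ▷ close (Πᵇ λ α → InOmega α ⇒ᵇ
              (Empty α ∨ᵇ (Σᵇ λ γ → γ ∈ᵇ α ∧ᵇ InOmega γ ∧ᵇ IsSucc α γ)))
  ω-cases = ∀I (lam (∃E (∀E 0 successor)
    (∨E (app (∀E 1 (app (∀E 0 (∧E₂ (# 1))) (# 0))) (app (∧E₂ (∀E 1 (# 0))) (∨I₂ (≐I 1))))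
      (∨I₁ (# 0))
      (∃E (# 0) (∨I₂ (∃I 0 (∧I
        (app (∧E₂ (∀E 0 (∧E₂ (# 0)))) (∨I₂ (≐I 0)))
        (∧I (app (app (app (app (∀E 0 (∀E 1 (∀E 2 ω-predecessor))) (# 3)) (# 2))
                      (∧E₁ (# 0)))
                 (∧E₂ (# 0)))
            (∧E₂ (# 0))))))))))

  math-induction : ∀ ψ {C} → C ▷ MathInductionOf (apply₁ ψ 0 1) (apply₁ ψ 0 2)
  math-induction ψ =
    lam (app (cast (SetInduction-InOmega≡ ψ) (pure (ax (t-ind (InOmega 0 1 ⇒ ψ)))))
    (∀I (lam (lam (∨E (app (∀E 0 ω-cases) (# 0))
      (leaf-cast 2 0 ψ (app (∀E 0 (∧E₁ (# 3))) (# 0)) refl refl (λ _ → refl))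
      (∃E (# 0) (leaf-cast 4 1 ψ
        (app (∀E 1 (app (∀E 0 (∧E₂ (# 4)))
                      (leaf-cast 2 3 ψ (app (app (∀E 0 (# 3)) (∧E₁ (# 0))) (∧E₁ (∧E₂ (# 0))))
                        refl refl (λ _ → refl))))
             (∧E₂ (∧E₂ (# 0))))
        refl refl (λ _ → refl))))))))

_⊆ᵇ_ : ℕ → ℕ → Bf
a ⊆ᵇ b = Πᵇ λ z → z ∈ᵇ a ⇒ᵇ z ∈ᵇ b

module Replacement (φ : Fm) where
  open Derivation 𝕋

  -- The derivations below run under the binders of x and of the n ∈ ω and f : n → x
  -- given by V = Fin, which have the levels x, n, f.  ImageUnionBelow is the
  -- induction formula in m (index 0) with parameters f, n, x (indices 1, 2, 3):
  -- if m ⊆ n, the union of the φ-images of the f-images of the elements of m exists.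

  x n f : ℕ
  x = 0
  n = 1
  f = 2

  ImageUnion : ℕ → ℕ → Bf
  ImageUnion m y = Πᵇ λ z → z ∈ᵇ y ⇔ᵇ
    (Σᵇ λ v → z ∈ᵇ v ∧ᵇ (Σ∈ m λ a → Σ∈ x λ u → Rel f a u ∧ᵇ apply₂ᵇ φ u v))

  ImageUnionBelow : Fm
  ImageUnionBelow = (3 ⊆ᵇ n ⇒ᵇ Σᵇ λ y → ImageUnion 3 y) 4

  Functional : Fm
  Functional = IsFunctional (apply₂ φ 1 0 2) (apply₂ φ 2 0 3)

  image-union-base : ∀ {C} → C ▷ InductionBase (apply₁ ImageUnionBelow 0 1)
  image-union-base = ∀I (lam (lam (∃I 0 (∀I (∧I
    (lam (⊥E (app (∀E 0 (# 2)) (# 0))))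
    (lam (∃E (# 0) (∃E (∧E₂ (# 0)) (⊥E (app (∀E 0 (# 4)) (∧E₁ (# 0))))))))))))

  image-union-replacement : ∀ {C} → C ▷ (InOmega n ∧ᵇ Bij f n x) 3 →
                            C ▷ InductionConclusion (apply₁ ImageUnionBelow 0 1) →
                            C ▷ shiftⁿ 2 (ReplacementUnion (apply₂ φ 0 1 5) 0 1)
  image-union-replacement ω∧bij image-union =
    cut ω∧bij (∃E (app (app (∀E 1 (wk image-union)) (∧E₁ (# 0))) (∀I (lam (# 0))))
      (∃I 0 (∀I (∧I
        (lam (∃E (app (∧E₁ (∀E 0 (# 1))) (# 0)) (∃E (∧E₂ (# 0)) (∃E (∧E₂ (# 0))
          (∃I 2 (∧I (∧E₁ (# 2)) (∃I 0 (∧I (∧E₁ (# 0))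
            (leaf-cast 4 9 φ (∧E₂ (∧E₂ (# 0))) refl refl (λ _ → refl))))))))))
        (lam (∃E (# 0) (∃E (∧E₂ (# 0))
          (∃E (app (∀E 0 (∧E₁ (∧E₂ (∧E₂ (∧E₂ (∧E₂ (# 4))))))) (∧E₁ (# 0)))
            (app (∧E₂ (∀E 3 (# 4))) (∃I 2 (∧I (∧E₁ (# 2)) (∃I 0 (∧I (∧E₁ (# 0))
              (∃I 1 (∧I (∧E₁ (# 1)) (∧I (∧E₂ (# 0))
                (leaf-cast 5 10 φ (∧E₂ (# 1)) refl refl (λ _ → refl))))))))))))))))))

  -- The union for m ∪ {m} is the union for m together with the v with φ(f(m), v).
  -- Conversely, an element a of m ∪ {m} outside m is m itself, and then f and φ being
  -- functional yield that same v.

  image-union-step : ∀ {C} → C ▷ shiftⁿ 3 Functional → C ▷ Bij f n x 3 →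
                     C ▷ InductionStep (apply₁ ImageUnionBelow 0 1) (apply₁ ImageUnionBelow 0 2)
  image-union-step functional bijection =
    cut functional (cut (wk bijection) (∀I (lam (∀I (lam (lam
    (cut (∀I (lam (app (∀E 0 (# 1)) (app (∧E₂ (∀E 0 (# 2))) (∨I₁ (# 0))))))
    (∃E (app (# 3) (# 0))
    (cut (app (∀E 2 (# 2)) (app (∧E₂ (∀E 2 (# 3))) (∨I₂ (≐I 2))))
    (∃E (app (∀E 2 (∧E₁ (∧E₂ (# 6)))) (# 0))
    (∃E (∀E 0 (# 8))
    (∃E (∀E 0 (∀E 2 binary-union))
    (∃I 0 (∀I (∧I
      (lam (∨E (app (∧E₁ (∀E 0 (# 1))) (# 0))
        (∃E (app (∧E₁ (∀E 0 (# 6))) (# 0)) (∃E (∧E₂ (# 0)) (∃E (∧E₂ (# 0))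
          (∃I 2 (∧I (∧E₁ (# 2)) (∃I 1 (∧I (app (∧E₂ (∀E 1 (# 12))) (∨I₁ (∧E₁ (# 1))))
            (∃I 0 (∧I (∧E₁ (# 0)) (∧I (∧E₁ (∧E₂ (# 0)))
              (leaf-cast 7 12 φ (∧E₂ (∧E₂ (# 0))) refl refl (λ _ → refl))))))))))))
        (∃I 2 (∧I (# 0) (∃I 6 (∧I (app (∧E₂ (∀E 6 (# 9))) (∨I₂ (≐I 6)))
          (∃I 3 (∧I (∧E₁ (# 4)) (∧I (∧E₂ (# 4))
            (leaf-cast 10 9 φ (∧E₁ (# 3)) refl refl (λ _ → refl)))))))))))
      (lam (∃E (# 0) (∃E (∧E₂ (# 0)) (∃E (∧E₂ (# 0))
        (app (∧E₂ (∀E 3 (# 4)))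
          (∨E (app (∧E₁ (∀E 1 (# 11))) (∧E₁ (# 1)))
            (∨I₁ (app (∧E₂ (∀E 3 (# 9)))
              (∃I 2 (∧I (∧E₁ (# 3)) (∃I 1 (∧I (# 0) (∃I 0 (∧I (∧E₁ (# 1)) (∧I (∧E₁ (∧E₂ (# 1)))
                (leaf-cast 6 13 φ (∧E₂ (∧E₂ (# 1))) refl refl (λ _ → refl)))))))))))
            (∨I₂ (∈-substʳ
              (app (∀E 2 (∧E₂ (# 6)))
                (leaf-cast 0 14 φ
                  (app (discharge (≐-rename φ (Equated-args₂ 0 6 2 13))
                         (app (app (∀E 6 (∀E 0 (∀E 9 (∧E₁ (∧E₂ (∧E₂ (# 14)))))))
                                   (≐-subst _ (# 0) (∧E₁ (∧E₂ (# 1)))))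
                              (∧E₂ (# 7))))
                       (leaf-cast 6 0 φ (∧E₂ (∧E₂ (# 1))) refl refl (λ _ → refl)))
                  refl refl (λ _ → refl)))
              (∧E₁ (# 3)))))))))))))))))))))))))

  union-replacement : ∀ {C} → C ▷ UnionReplacement φ
  union-replacement = cast (sym (UnionReplacement≡ φ)) (lam (∀I
    (∃E (∀E 0 (pure (ax t-fin))) (∃E (# 0)
      (image-union-replacement (# 0)
        (app (math-induction ImageUnionBelow)
          (∧I image-union-base (image-union-step (# 2) (∧E₂ (# 0))))))))))

module _ where
  open Derivation 𝕋
  open Replacement using (union-replacement)

  ACSTfin+SI-axioms-in-𝕋 : ∀ A → ACSTfin+SI A → 𝕋 ⊢ A
  ACSTfin+SI-axioms-in-𝕋 _ a-ext     = ax t-ext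
  ACSTfin+SI-axioms-in-𝕋 _ a-empty   = closed empty-set
  ACSTfin+SI-axioms-in-𝕋 _ a-inter   = ax t-inter
  ACSTfin+SI-axioms-in-𝕋 _ a-pair    = ax t-pair
  ACSTfin+SI-axioms-in-𝕋 _ (a-urr φ) = closed (union-replacement φ)
  ACSTfin+SI-axioms-in-𝕋 _ (a-mi ψ)  = closed (cast (sym (MathInduction≡ ψ)) (math-induction ψ))
  ACSTfin+SI-axioms-in-𝕋 _ a-fin     = ax t-fin
  ACSTfin+SI-axioms-in-𝕋 _ (a-ind φ) = ax (t-ind φ)

mainTheorem9 : SameTheory 𝕋 ACSTfin+SI
mainTheorem9 = 𝕋-axioms-in-ACSTfin+SI , ACSTfin+SI-axioms-in-𝕋
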